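{- Let $M(n)$ be an upper bound on the number of messages used by one invocation of the maximum protocol or of the minimum protocol (on at most $n$ participating nodes) inside the Top-$k$-Position Monitoring algorithm described in the context, and let $\Delta=\max_t\,(v_{(k)}^t-v_{(k+1)}^t)$, where $v_{(k)}^t$ and $v_{(k+1)}^t$ are the $k$-th and $(k+1)$-st largest values among $v_1^t,\dots,v_n^t$. Then this algorithm is $O\big((\log\Delta+k)\cdot M(n)\big)$-competitive.
   Context: Model: $n$ nodes with IDs $1,\dots,n$ and one coordinator. Node $i$ observes an online stream $v_i^1,v_i^2,\dots\in\mathbb{N}$ (it knows $v_i^t$ at time $t$ but no future values); values are pairwise distinct at every time. A node can send a message to the coordinator, the coordinator can send a message to one node or broadcast one message to all nodes; every message costs one unit. Between consecutive time steps an arbitrary communication protocol may be run. Top-$k$-Position Monitoring: at every time $t$ the coordinator must know the set (top-$k$) of IDs of the nodes holding the $k$ largest values at time $t$. Filters: a set of filters at time $t$ is an $n$-tuple of intervals $F_i=[l_i,u_i]\subseteq\mathbb{N}\cup\{ -\infty,\infty\}$ with $v_i^t\in F_i$ such that, as long as each node's value stays in its interval, the top-$k$ set does not change. A filter-based algorithm lets the coordinator assign intervals that always form a set of filters; a node violates its filter when its value leaves its interval. OPT is an optimal offline filter-based algorithm (knowing all streams in advance), whose cost is its number of messages (at least its number of filter updates). An online algorithm is $c$-competitive if on every instance its (expected, if randomized) number of messages is at most $c$ times that of OPT. The algorithm assumes a MaximumProtocol (resp. MinimumProtocol) which, run by a set of nodes at a fixed time, lets the coordinator learn the maximum (resp.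 minimum) value among them and its holder. FilterReset (also run at time $0$): the coordinator applies the MaximumProtocol $k+1$ times, each time to all nodes not yet found, thereby learning the $k+1$ largest values; it sets $M$ to the midpoint between the $k$-th and $(k+1)$-st largest values and broadcasts $M$; the current top-$k$ nodes set their filters to $[M,\infty]$ and all other nodes to $[-\infty,M]$; the time $t_0$ of this reset starts a new phase, with $T^+$ initialised to the $k$-th and $T^-$ to the $(k+1)$-st largest value. At each time $t>0$: violating nodes that were in top-$k$ at time $t-1$ run the MinimumProtocol among themselves, violating nodes not in top-$k$ at $t-1$ run the MaximumProtocol among themselves. If any value was communicated, the coordinator runs the FilterViolationHandler: let $min$ be the minimum so obtained (if any) and $max$ the maximum so obtained (if any); if $max$ is not set, it computes $max$ by running the MaximumProtocol on all nodes not in top-$k$ at $t-1$; otherwise it computes $min$ by running the MinimumProtocol on all nodes in top-$k$ at $t-1$. It updates $T^+\leftarrow\min(T^+,min)$ and $T^-\leftarrow\max(T^-,max)$. If $T^+<T^-$ it calls FilterReset; otherwise it broadcasts the midpoint $M$ of $[T^-,T^+]$ and nodes update their filters to $[M,\infty]$ (top-$k$ nodes) or $[-\infty,M]$ (others). -}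

module Defs where

open import Data.Nat.Base using (ℕ; zero; suc; _+_; _*_; _∸_; _≤_; _⊓_; _⊔_; ⌊_/2⌋; _<ᵇ_)
open import Data.Bool.Base using (Bool; true; false; if_then_else_; not; _∧_; _∨_)
open import Data.Fin.Base using (Fin)
open import Data.List.Base using (List; []; _∷_; map; foldr; filterᵇ; allFin)
open import Data.Nat.ListAction using (sum)
open import Data.Bool.ListAction using (any)
open import Data.Product.Base using (_×_; _,_; proj₁; proj₂)
open import Relation.Binary.PropositionalEquality using (_≡_)
open import Function.Definitions using (Injective)

data Ext : Set where
  -∞  : Ext
  fin : ℕ → Ext
  +∞  : Ext

data _≤E_ : Ext → Ext → Set where
  -∞≤    : ∀ {e} → -∞ ≤E e
  fin≤   : ∀ {a b} → a ≤ b → fin a ≤E fin b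
  ≤+∞    : ∀ {e} → e ≤E +∞

_==E_ : Ext → Ext → Bool
-∞ ==E -∞ = true
fin a ==E fin b = (a <ᵇ suc b) ∧ (b <ᵇ suc a)
+∞ ==E +∞ = true
_ ==E _ = false

Interval : Set
Interval = Ext × Ext

_∈I_ : ℕ → Interval → Set
x ∈I (l , u) = (l ≤E fin x) × (fin x ≤E u)

_==I_ : Interval → Interval → Bool
(l , u) ==I (l' , u') = (l ==E l') ∧ (u ==E u')

Filters : ℕ → Set
Filters n = Fin n → Interval

-- Top-k set of a value vector (values pairwise distinct):
-- node i is in the top-k iff fewer than k nodes hold a larger value.

countGreater : ∀ {n} → (Fin n → ℕ) → Fin n → ℕ
countGreater {n} w i = sum (map (λ j → if w i <ᵇ w j then 1 else 0) (allFin n))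

inTop : ∀ {n} → ℕ → (Fin n → ℕ) → Fin n → Bool
inTop k w i = countGreater w i <ᵇ k

IsFilterSet : ∀ {n} → ℕ → (Fin n → ℕ) → Filters n → Set
IsFilterSet {n} k v F =
  ((i : Fin n) → v i ∈I F i) ×
  ((w : Fin n → ℕ) → Injective _≡_ _≡_ w → ((i : Fin n) → w i ∈I F i) →
     (i : Fin n) → inTop k w i ≡ inTop k v i)

ValidSchedule : ∀ {n} → ℕ → (ℕ → Fin n → ℕ) → ℕ → (ℕ → Filters n) → Set
ValidSchedule k v T F = ∀ t → t ≤ T → IsFilterSet k (v t) (F t)

changed : ∀ {n} → Filters n → Filters n → Bool
changed {n} F G = any (λ i → not (F i ==I G i)) (allFin n)

numChanges : ∀ {n} → (ℕ → Filters n) → ℕ → ℕ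
numChanges F zero = 0
numChanges F (suc t) = numChanges F t + (if changed (F t) (F (suc t)) then 1 else 0)

-- cost of the offline schedule: one message for the initial assignment
-- plus one (broadcast) message per time step at which filters change.
scheduleCost : ∀ {n} → (ℕ → Filters n) → ℕ → ℕ
scheduleCost F T = 1 + numChanges F T

-- Auxiliary: min / max of a list (default 0 on the empty list)

minList : List ℕ → ℕ
minList [] = 0
minList (x ∷ xs) = foldr _⊓_ x xs

maxList : List ℕ → ℕ
maxList [] = 0
maxList (x ∷ xs) = foldr _⊔_ x xs

valsWhere : ∀ {n} → (Fin n → Bool) → (Fin n → ℕ) → List ℕ
valsWhere {n} S w = map w (filterᵇ S (allFin n))

gap : ∀ {n} → ℕ → (Fin n → ℕ) → ℕ
gap k w = minList (valsWhere (inTop k w) w) ∸ maxList (valsWhere (λ i → not (inTop k w i)) w)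

Δ : ∀ {n} → ℕ → (ℕ → Fin n → ℕ) → ℕ → ℕ
Δ k v zero = gap k (v 0)
Δ k v (suc t) = Δ k v t ⊔ gap k (v (suc t))

-- The online algorithm.  Each invocation of the Maximum/Minimum protocol
-- is charged m messages (m = M(n), the worst-case bound), each broadcast 1.

record State (n : ℕ) : Set where
  constructor st
  field
    top : Fin n → Bool
    thr : ℕ
    T⁺  : ℕ
    T⁻  : ℕ
open State public

mid : ℕ → ℕ → ℕ
mid a b = ⌊ a + b /2⌋

resetState : ∀ {n} → ℕ → (Fin n → ℕ) → State n
resetState k w =
  let S  = inTop k w
      a  = minList (valsWhere S w)
      b  = maxList (valsWhere (λ i → not (S i)) w)
  in st S (mid b a) a b

-- k+1 MaximumProtocol invocations plus one broadcast
resetCost : ℕ → ℕ → ℕ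
resetCost k m = (k + 1) * m + 1

b2n : Bool → ℕ
b2n true = 1
b2n false = 0

step : ∀ {n} → ℕ → ℕ → (Fin n → ℕ) → State n → ℕ × State n
step {n} k m w s =
  let S   = top s
      M   = thr s
      vt  = any (λ i → S i ∧ (w i <ᵇ M)) (allFin n)
      vo  = any (λ i → not (S i) ∧ (M <ᵇ w i)) (allFin n)
      inv = b2n vt + b2n vo + 1
      mn  = minList (valsWhere S w)
      mx  = maxList (valsWhere (λ i → not (S i)) w)
      Tp  = T⁺ s ⊓ mn
      Tm  = T⁻ s ⊔ mx
  in if vt ∨ vo
     then (if Tp <ᵇ Tm
           then (inv * m + resetCost k m , resetState k w)
           else (inv * m + 1 , st S (mid Tm Tp) Tp Tm))
     else (0 , s)

run : ∀ {n} → ℕ → ℕ → (ℕ → Fin n → ℕ) → ℕ → ℕ × State n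
run k m v zero = (resetCost k m , resetState k (v 0))
run k m v (suc t) =
  let r = run k m v t
      s = step k m (v (suc t)) (proj₂ r)
  in (proj₁ r + proj₁ s , proj₂ s)

algCost : ∀ {n} → ℕ → ℕ → (ℕ → Fin n → ℕ) → ℕ → ℕ
algCost k m v T = proj₁ (run k m v T)

module Submission where

-- The run is cut into phases, each beginning with a FilterReset.  Within a
-- phase the algorithm keeps an interval [T⁻, T⁺]; T⁺ is witnessed by a value
-- some top-k node held during the phase, T⁻ by a value some other node held.
-- (1) Every narrowing call of the FilterViolationHandler at least halves the
--     interval, which started with length gap + 1 ≤ Δ + 1, so a phase has at
--     most ⌊log₂ Δ⌋ + 1 of them ('midpoint-halves', 'log-bound').
-- (2) A phase ends only when the witnesses cross.  If the offline schedule
--     kept its filters G throughout the phase, all values seen lie in G, and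
--     a hybrid of two value vectors shows that inside a filter set every
--     top-k value dominates every other value ('separation'); so the offline
--     schedule changed its filters, and that change pays for the phase.

open import Defs
open import Data.Nat.Base using (ℕ; _+_; _*_; _≤_; _<_)
open import Data.Nat.Logarithm using (⌊log₂_⌋)
open import Data.Fin.Base using (Fin)
open import Data.Product using (∃-syntax)
open import Relation.Binary.PropositionalEquality using (_≡_)
open import Function.Definitions using (Injective)

open import Data.Nat.Base
  using (zero; suc; _∸_; _^_; _⊓_; _⊔_; ⌊_/2⌋; _<ᵇ_; _≤ᵇ_; z≤n; s≤s; _≤′_; ≤′-refl; ≤′-step)
open import Data.Nat.Properties hiding (_≟_)
open import Data.Nat.Logarithm using (⌊log₂⌋-mono-≤; ⌊log₂[2^n]⌋≡n)
open import Data.Nat.ListAction using (sum)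
open import Data.Nat.Tactic.RingSolver using (solve-∀)
open import Data.Fin.Base using (fromℕ<)
open import Data.Fin.Properties using (_≟_)
open import Data.Bool.Base using (Bool; true; false; not; _∧_; _∨_; T; if_then_else_)
open import Data.Bool.Properties using (T-≡; ∧-conicalˡ; ∧-conicalʳ; not-injective)
open import Data.Bool.ListAction using (any)
open import Data.List.Base using ([]; _∷_; map; allFin)
open import Data.List.Properties using (foldr-preservesᵒ)
open import Data.List.Relation.Unary.Any as Any using (Any; here; there)
open import Data.List.Relation.Unary.Any.Properties using (any⁺; any⁻)
open import Data.List.Relation.Unary.All as All using ()
open import Data.List.Extrema.Nat using (argmax; f[xs]≤f[argmax])
open import Data.List.Membership.Propositional using (_∈_)
open import Data.List.Membership.Propositional.Properties
  using (∈-map⁺; ∈-map⁻; ∈-filter⁺; ∈-filter⁻; ∈-allFin; foldr-selective)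
open import Data.Product using (_×_; _,_; proj₁; proj₂)
open import Data.Sum as Sum using (_⊎_; inj₁; inj₂)
open import Data.Empty using (⊥; ⊥-elim)
open import Function.Bundles using (Equivalence)
open import Relation.Nullary using (yes; no; does; ofʸ; ofⁿ)
open import Relation.Nullary.Decidable using (T?)
open import Relation.Binary.PropositionalEquality using (refl; sym; trans; cong; cong₂; subst; subst₂)

minList-≤ : ∀ xs {y} → y ∈ xs → minList xs ≤ y
minList-≤ (x ∷ xs) {y} y∈ = foldr-preservesᵒ keep x xs (bound y∈)
  where
  keep : ∀ a b → a ≤ y ⊎ b ≤ y → a ⊓ b ≤ y
  keep a b (inj₁ a≤y) = m≤n⇒m⊓o≤n b a≤y
  keep a b (inj₂ b≤y) = m≤n⇒o⊓m≤n a b≤y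
  bound : y ∈ x ∷ xs → x ≤ y ⊎ Any (_≤ y) xs
  bound (here refl) = inj₁ ≤-refl
  bound (there y∈xs) = inj₂ (Any.map (λ y≡z → ≤-reflexive (sym y≡z)) y∈xs)

maxList-≥ : ∀ xs {y} → y ∈ xs → y ≤ maxList xs
maxList-≥ (x ∷ xs) {y} y∈ = foldr-preservesᵒ keep x xs (bound y∈)
  where
  keep : ∀ a b → y ≤ a ⊎ y ≤ b → y ≤ a ⊔ b
  keep a b (inj₁ y≤a) = m≤n⇒m≤n⊔o b y≤a
  keep a b (inj₂ y≤b) = m≤n⇒m≤o⊔n a y≤b
  bound : y ∈ x ∷ xs → y ≤ x ⊎ Any (y ≤_) xs
  bound (here refl) = inj₁ ≤-refl
  bound (there y∈xs) = inj₂ (Any.map ≤-reflexive y∈xs)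

minList-∈ : ∀ xs {y} → y ∈ xs → minList xs ∈ xs
minList-∈ (x ∷ xs) _ with foldr-selective ⊓-sel x xs
... | inj₁ min≡x  = here min≡x
... | inj₂ min∈xs = there min∈xs

maxList-∈ : ∀ xs → maxList xs ≡ 0 ⊎ maxList xs ∈ xs
maxList-∈ [] = inj₁ refl
maxList-∈ (x ∷ xs) with foldr-selective ⊔-sel x xs
... | inj₁ max≡x  = inj₂ (here max≡x)
... | inj₂ max∈xs = inj₂ (there max∈xs)

true≢false : true ≡ false → ⊥
true≢false ()

<ᵇ⇒<′ : ∀ {a b} → (a <ᵇ b) ≡ true → a < b
<ᵇ⇒<′ {a} {b} e = <ᵇ⇒< a b (Equivalence.from T-≡ e)

<⇒<ᵇ′ : ∀ {a b} → a < b → (a <ᵇ b) ≡ true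
<⇒<ᵇ′ a<b = Equivalence.to T-≡ (<⇒<ᵇ a<b)

module _ {n : ℕ} (S : Fin n → Bool) (w : Fin n → ℕ) where

  ∈-valsWhere⁺ : ∀ {i} → S i ≡ true → w i ∈ valsWhere S w
  ∈-valsWhere⁺ {i} Si = ∈-map⁺ w (∈-filter⁺ (λ j → T? (S j)) (∈-allFin i) (Equivalence.from T-≡ Si))

  ∈-valsWhere⁻ : ∀ {y} → y ∈ valsWhere S w → ∃[ i ] (S i ≡ true × y ≡ w i)
  ∈-valsWhere⁻ y∈ with ∈-map⁻ w y∈
  ... | i , i∈ , y≡wi = i , Equivalence.to T-≡ (proj₂ (∈-filter⁻ (λ j → T? (S j)) {xs = allFin n} i∈)) , y≡wi

  minWhere-≤ : ∀ {i} → S i ≡ true → minList (valsWhere S w) ≤ w i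
  minWhere-≤ Si = minList-≤ _ (∈-valsWhere⁺ Si)

  maxWhere-≥ : ∀ {i} → S i ≡ true → w i ≤ maxList (valsWhere S w)
  maxWhere-≥ Si = maxList-≥ _ (∈-valsWhere⁺ Si)

  minWhere-attained : ∀ {i} → S i ≡ true → ∃[ p ] (S p ≡ true × minList (valsWhere S w) ≡ w p)
  minWhere-attained Si = ∈-valsWhere⁻ (minList-∈ _ (∈-valsWhere⁺ Si))

  maxWhere-attained : maxList (valsWhere S w) ≡ 0 ⊎ ∃[ q ] (S q ≡ true × maxList (valsWhere S w) ≡ w q)
  maxWhere-attained with maxList-∈ (valsWhere S w)
  ... | inj₁ max≡0  = inj₁ max≡0
  ... | inj₂ max∈   = inj₂ (∈-valsWhere⁻ max∈)

sum-map-≤ : ∀ {A : Set} (f g : A → ℕ) xs → (∀ x → f x ≤ g x) → sum (map f xs) ≤ sum (map g xs)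
sum-map-≤ f g []       f≤g = z≤n
sum-map-≤ f g (x ∷ xs) f≤g = +-mono-≤ (f≤g x) (sum-map-≤ f g xs f≤g)

sum-map-0 : ∀ {A : Set} (f : A → ℕ) xs → (∀ x → f x ≡ 0) → sum (map f xs) ≡ 0
sum-map-0 f []       f≡0 = refl
sum-map-0 f (x ∷ xs) f≡0 = cong₂ _+_ (f≡0 x) (sum-map-0 f xs f≡0)

module _ {n : ℕ} (k : ℕ) (w : Fin n → ℕ) where

  countGreater-antitone : ∀ {a b} → w a < w b → countGreater w b ≤ countGreater w a
  countGreater-antitone {a} {b} wa<wb = sum-map-≤ _ _ (allFin n) fewer
    where
    fewer : ∀ j → (if w b <ᵇ w j then 1 else 0) ≤ (if w a <ᵇ w j then 1 else 0)
    fewer j with w b <ᵇ w j | <ᵇ-reflects-< (w b) (w j) | w a <ᵇ w j | <ᵇ-reflects-< (w a) (w j)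
    ... | false | _         | _     | _          = z≤n
    ... | true  | _         | true  | _          = ≤-refl
    ... | true  | ofʸ wb<wj | false | ofⁿ wa≮wj  = ⊥-elim (wa≮wj (<-trans wa<wb wb<wj))

  inTop⇒ : ∀ {i} → inTop k w i ≡ true → countGreater w i < k
  inTop⇒ = <ᵇ⇒<′

  ⇒inTop : ∀ {i} → countGreater w i < k → inTop k w i ≡ true
  ⇒inTop = <⇒<ᵇ′

  inTop-upward : ∀ {a b} → w a < w b → inTop k w a ≡ true → inTop k w b ≡ true
  inTop-upward wa<wb a∈top = ⇒inTop (≤-<-trans (countGreater-antitone wa<wb) (inTop⇒ a∈top))

  -- a node holding the maximum value has no value above it
  inTop-nonempty : 1 ≤ k → Fin n → ∃[ p ] (inTop k w p ≡ true)
  inTop-nonempty 1≤k i₀ = p , ⇒inTop (subst (_< k) (sym noneAbove) 1≤k)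
    where
    p : Fin n
    p = argmax w i₀ (allFin n)
    maximal : ∀ j → w j ≤ w p
    maximal j = All.lookup (f[xs]≤f[argmax] {f = w} i₀ (allFin n)) (∈-allFin j)
    noneAbove : countGreater w p ≡ 0
    noneAbove = sum-map-0 _ (allFin n) zeroTerm
      where
      zeroTerm : ∀ j → (if w p <ᵇ w j then 1 else 0) ≡ 0
      zeroTerm j with w p <ᵇ w j | <ᵇ-reflects-< (w p) (w j)
      ... | false | _         = refl
      ... | true  | ofʸ wp<wj = ⊥-elim (<⇒≱ wp<wj (maximal j))

-- Then every top-k node of v₀ holds
-- in u at least the value any other node holds in u′.  Otherwise, with
-- u p < u′ q for a top node p and a non-top node q, the hybrid vector taking
-- u′ on q and on all nodes whose u-value is at least u′ q, and u elsewhere,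
-- is admissible and inside G, yet places q above p.

module Separation {n : ℕ} (k : ℕ) {G : Filters n} {v₀ : Fin n → ℕ} (G-filters : IsFilterSet k v₀ G)
  {u u′ : Fin n → ℕ} (u-inj : Injective _≡_ _≡_ u) (u′-inj : Injective _≡_ _≡_ u′)
  (u∈G : ∀ i → u i ∈I G i) (u′∈G : ∀ i → u′ i ∈I G i)
  {p q : Fin n} (p-top : inTop k v₀ p ≡ true) (q-rest : inTop k v₀ q ≡ false)
  (up<u′q : u p < u′ q) where

  sameTop : (x : Fin n → ℕ) → Injective _≡_ _≡_ x → (∀ i → x i ∈I G i) → ∀ i → inTop k x i ≡ inTop k v₀ i
  sameTop = proj₂ G-filters

  top-u : ∀ i → inTop k u i ≡ inTop k v₀ i
  top-u = sameTop u u-inj u∈G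

  top-u′ : ∀ i → inTop k u′ i ≡ inTop k v₀ i
  top-u′ = sameTop u′ u′-inj u′∈G

  y : ℕ
  y = u′ q

  C : Fin n → Bool
  C i = does (i ≟ q) ∨ (y ≤ᵇ u i)

  hybrid : Fin n → ℕ
  hybrid i = if C i then u′ i else u i

  -- a node other than q with u-value ≥ y lies above p, hence in the top-k,
  -- and so (as q is not in the top-k of u′) its u′-value is ≥ y too
  C⇒≥ : ∀ i → C i ≡ true → y ≤ u′ i
  C⇒≥ i Ci with i ≟ q | y ≤ᵇ u i | ≤ᵇ-reflects-≤ y (u i)
  ... | yes refl | _    | _           = ≤-refl
  ... | no _     | true | ofʸ y≤ui    = ≮⇒≥ q-below-i
    where
    i-top : inTop k v₀ i ≡ true
    i-top = trans (sym (top-u i)) (inTop-upward k u (<-≤-trans up<u′q y≤ui) (trans (top-u p) p-top))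
    q-below-i : u′ i < y → ⊥
    q-below-i u′i<y = true≢false (trans (sym q-top′) (trans (top-u′ q) q-rest))
      where
      q-top′ : inTop k u′ q ≡ true
      q-top′ = inTop-upward k u′ u′i<y (trans (top-u′ i) i-top)

  ¬C⇒< : ∀ i → C i ≡ false → u i < y
  ¬C⇒< i ¬Ci with i ≟ q | y ≤ᵇ u i | ≤ᵇ-reflects-≤ y (u i)
  ... | no _ | false | ofⁿ y≰ui = ≰⇒> y≰ui

  hybrid-inj : Injective _≡_ _≡_ hybrid
  hybrid-inj {a} {b} e with C a in Ca | C b in Cb
  ... | true  | true  = u′-inj e
  ... | false | false = u-inj e
  ... | true  | false = ⊥-elim (<⇒≱ (¬C⇒< b Cb) (≤-trans (C⇒≥ a Ca) (≤-reflexive e)))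
  ... | false | true  = ⊥-elim (<⇒≱ (¬C⇒< a Ca) (≤-trans (C⇒≥ b Cb) (≤-reflexive (sym e))))

  hybrid∈G : ∀ i → hybrid i ∈I G i
  hybrid∈G i with C i
  ... | true  = u′∈G i
  ... | false = u∈G i

  hybrid-p : hybrid p ≡ u p
  hybrid-p with p ≟ q | y ≤ᵇ u p | ≤ᵇ-reflects-≤ y (u p)
  ... | yes refl | _    | _         = ⊥-elim (true≢false (trans (sym p-top) q-rest))
  ... | no _     | true | ofʸ y≤up = ⊥-elim (<⇒≱ up<u′q y≤up)
  ... | no _     | false | _        = refl

  hybrid-q : hybrid q ≡ y
  hybrid-q with q ≟ q
  ... | yes _  = refl
  ... | no q≢q = ⊥-elim (q≢q refl)

  -- in the hybrid, q lies above the top node p, so it is in the top-k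
  contradiction : ⊥
  contradiction = true≢false (trans (sym q-top) (trans (top-hybrid q) q-rest))
    where
    top-hybrid : ∀ i → inTop k hybrid i ≡ inTop k v₀ i
    top-hybrid = sameTop hybrid hybrid-inj hybrid∈G
    q-top : inTop k hybrid q ≡ true
    q-top = inTop-upward k hybrid (subst₂ _<_ (sym hybrid-p) (sym hybrid-q) up<u′q) (trans (top-hybrid p) p-top)

separation : ∀ {n} (k : ℕ) {G : Filters n} {v₀ : Fin n → ℕ} → IsFilterSet k v₀ G →
  {u u′ : Fin n → ℕ} → Injective _≡_ _≡_ u → Injective _≡_ _≡_ u′ →
  (∀ i → u i ∈I G i) → (∀ i → u′ i ∈I G i) →
  {p q : Fin n} → inTop k v₀ p ≡ true → inTop k v₀ q ≡ false → u′ q ≤ u p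
separation k G-filters u-inj u′-inj u∈G u′∈G p-top q-rest =
  ≮⇒≥ (Separation.contradiction k G-filters u-inj u′-inj u∈G u′∈G p-top q-rest)

==E-sound : ∀ a b → (a ==E b) ≡ true → a ≡ b
==E-sound -∞      -∞      _ = refl
==E-sound +∞      +∞      _ = refl
==E-sound (fin a) (fin b) e = cong fin (≤-antisym (≤-pred (<ᵇ⇒<′ a≤b)) (≤-pred (<ᵇ⇒<′ b≤a)))
  where
  a≤b : (a <ᵇ suc b) ≡ true
  a≤b = ∧-conicalˡ (a <ᵇ suc b) (b <ᵇ suc a) e
  b≤a : (b <ᵇ suc a) ≡ true
  b≤a = ∧-conicalʳ (a <ᵇ suc b) (b <ᵇ suc a) e
==E-sound -∞      (fin _) ()
==E-sound -∞      +∞      ()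
==E-sound (fin _) -∞      ()
==E-sound (fin _) +∞      ()
==E-sound +∞      -∞      ()
==E-sound +∞      (fin _) ()

==I-sound : ∀ I J → (I ==I J) ≡ true → I ≡ J
==I-sound (l , u) (l′ , u′) e =
  cong₂ _,_ (==E-sound l l′ (∧-conicalˡ _ _ e)) (==E-sound u u′ (∧-conicalʳ _ _ e))

unchanged : ∀ {n} (F G : Filters n) → changed F G ≡ false → ∀ i → F i ≡ G i
unchanged {n} F G e i with F i ==I G i in same
... | true  = ==I-sound (F i) (G i) same
... | false = ⊥-elim (true≢false (trans (sym (Equivalence.to T-≡ differs)) e))
  where
  differs : T (changed F G)
  differs = any⁺ _ (Any.map (λ { refl → subst (λ b → T (not b)) (sym same) _ }) (∈-allFin i))

numChanges-mono : ∀ {n} (F : ℕ → Filters n) {t₀ t} → t₀ ≤ t → numChanges F t₀ ≤ numChanges F t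
numChanges-mono F t₀≤t = go (≤⇒≤′ t₀≤t)
  where
  go : ∀ {t₀ t} → t₀ ≤′ t → numChanges F t₀ ≤ numChanges F t
  go ≤′-refl       = ≤-refl
  go (≤′-step le)  = ≤-trans (go le) (m≤m+n _ _)

numChanges-stable : ∀ {n} (F : ℕ → Filters n) {t₀ t} → t₀ ≤ t → numChanges F t ≤ numChanges F t₀ →
  ∀ i → F t i ≡ F t₀ i
numChanges-stable F t₀≤t = go (≤⇒≤′ t₀≤t)
  where
  go : ∀ {t₀ t} → t₀ ≤′ t → numChanges F t ≤ numChanges F t₀ → ∀ i → F t i ≡ F t₀ i
  go ≤′-refl _ i = refl
  go {t₀} (≤′-step {t} le) stays i with changed (F t) (F (suc t)) in e
  ... | true  = ⊥-elim (<⇒≱ (≤-trans (≤-reflexive (+-comm 1 _)) stays) (numChanges-mono F (≤′⇒≤ le)))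
  ... | false = trans (sym (unchanged (F t) (F (suc t)) e i))
                      (go le (≤-trans (≤-reflexive (sym (+-identityʳ _))) stays) i)

double : ∀ x → 2 * x ≡ x + x
double x = cong (x +_) (+-identityʳ x)

half+half≤ : ∀ x → ⌊ x /2⌋ + ⌊ x /2⌋ ≤ x
half+half≤ x = ≤-trans (+-monoʳ-≤ ⌊ x /2⌋ (⌊n/2⌋≤⌈n/2⌉ x)) (≤-reflexive (⌊n/2⌋+⌈n/2⌉≡n x))

≤1+half+half : ∀ x → x ≤ suc (⌊ x /2⌋ + ⌊ x /2⌋)
≤1+half+half zero          = z≤n
≤1+half+half (suc zero)    = s≤s z≤n
≤1+half+half (suc (suc x)) rewrite +-suc ⌊ x /2⌋ ⌊ x /2⌋ = s≤s (s≤s (≤1+half+half x))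

mid-shift : ∀ a x → mid a (a + x) ≡ a + ⌊ x /2⌋
mid-shift zero    x = refl
mid-shift (suc a) x rewrite +-suc a (a + x) = cong suc (mid-shift a x)

-- the halving estimate for [f, f + d] ⊆ [0, f + d + r]
halving-offsets : ∀ f d r → let h = ⌊ f + d + r /2⌋ in
  (f + d < h ⊎ h < f) → 2 * (d + 1) ≤ f + d + r + 1
halving-offsets f d r (inj₁ f+d<h) = begin
  2 * (d + 1)        ≡⟨ double (d + 1) ⟩
  (d + 1) + (d + 1)  ≤⟨ +-mono-≤ d+1≤h d+1≤h ⟩
  h + h              ≤⟨ half+half≤ X ⟩
  X                  ≤⟨ m≤m+n X 1 ⟩
  X + 1              ∎
  where
  open ≤-Reasoning
  X h : ℕ
  X = f + d + r
  h = ⌊ X /2⌋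
  d+1≤h : d + 1 ≤ h
  d+1≤h = ≤-trans (≤-reflexive (+-comm d 1)) (≤-trans (s≤s (m≤n+m d f)) f+d<h)
halving-offsets f d r (inj₂ h<f) = begin
  2 * (d + 1)        ≡⟨ double (d + 1) ⟩
  (d + 1) + (d + 1)  ≤⟨ +-monoʳ-≤ (d + 1) d+1≤f+r ⟩
  (d + 1) + (f + r)  ≡⟨ regroup f d r ⟩
  X + 1              ∎
  where
  open ≤-Reasoning
  X h : ℕ
  X = f + d + r
  h = ⌊ X /2⌋
  regroup : ∀ f d r → (d + 1) + (f + r) ≡ f + d + r + 1
  regroup = solve-∀
  -- X + 1 ≤ 2 (h + 1) ≤ 2 f, so the part d + r + 1 beyond f fits into f
  d+r+1≤f : d + r + 1 ≤ f
  d+r+1≤f = +-cancelˡ-≤ f _ _ (begin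
    f + (d + r + 1)    ≡⟨ regroup′ f d r ⟩
    X + 1              ≤⟨ +-monoˡ-≤ 1 (≤1+half+half X) ⟩
    suc (h + h) + 1    ≡⟨ cong suc (trans (+-comm (h + h) 1) (sym (+-suc h h))) ⟩
    suc h + suc h      ≤⟨ +-mono-≤ h<f h<f ⟩
    f + f              ∎)
    where
    regroup′ : ∀ f d r → f + (d + r + 1) ≡ f + d + r + 1
    regroup′ = solve-∀
  d+1≤f+r : d + 1 ≤ f + r
  d+1≤f+r = ≤-trans (+-monoˡ-≤ 1 (m≤m+n d r)) (≤-trans d+r+1≤f (m≤m+n f r))

midpoint-halves : ∀ {a x y b} → a ≤ x → x ≤ y → y ≤ b → (y < mid a b ⊎ mid a b < x) →
  2 * (y ∸ x + 1) ≤ b ∸ a + 1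
midpoint-halves {a} a≤x x≤y y≤b avoids with m≤n⇒∃[o]m+o≡n a≤x
... | f , refl with m≤n⇒∃[o]m+o≡n x≤y
... | d , refl with m≤n⇒∃[o]m+o≡n y≤b
... | r , refl = subst₂ (λ l L → 2 * (l + 1) ≤ L + 1) (sym y-x) (sym b-a) (halving-offsets f d r offsets)
  where
  assoc : a + f + d + r ≡ a + (f + d + r)
  assoc = trans (cong (_+ r) (+-assoc a f d)) (+-assoc a (f + d) r)
  y-x : a + f + d ∸ (a + f) ≡ d
  y-x = m+n∸m≡n (a + f) d
  b-a : a + f + d + r ∸ a ≡ f + d + r
  b-a = trans (cong (_∸ a) assoc) (m+n∸m≡n a (f + d + r))
  mid≡ : mid a (a + f + d + r) ≡ a + ⌊ f + d + r /2⌋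
  mid≡ = trans (cong (mid a) assoc) (mid-shift a (f + d + r))
  offsets : f + d < ⌊ f + d + r /2⌋ ⊎ ⌊ f + d + r /2⌋ < f
  offsets = Sum.map (λ y<mid → +-cancelˡ-< a _ _ (subst₂ _<_ (+-assoc a f d) mid≡ y<mid))
                    (λ mid<x → +-cancelˡ-< a _ _ (subst (_< a + f) mid≡ mid<x))
                    avoids

log-bound : ∀ j x → 2 ^ j ≤ x + 1 → j ≤ ⌊log₂ x ⌋ + 1
log-bound zero    x _  = z≤n
log-bound (suc j) x le = subst (_≤ ⌊log₂ x ⌋ + 1) (+-comm j 1) (+-monoˡ-≤ 1 j≤log)
  where
  2^j≤x : 2 ^ j ≤ x
  2^j≤x = +-cancelʳ-≤ 1 (2 ^ j) x (begin
    2 ^ j + 1          ≤⟨ +-monoʳ-≤ (2 ^ j) (m^n>0 2 j) ⟩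
    2 ^ j + 2 ^ j      ≡⟨ sym (double (2 ^ j)) ⟩
    2 ^ suc j          ≤⟨ le ⟩
    x + 1              ∎)
    where open ≤-Reasoning
  j≤log : j ≤ ⌊log₂ x ⌋
  j≤log = subst (_≤ ⌊log₂ x ⌋) (⌊log₂[2^n]⌋≡n j) (⌊log₂⌋-mono-≤ 2^j≤x)

module _ {n : ℕ} where

  newT⁺ : State n → (Fin n → ℕ) → ℕ
  newT⁺ s w = T⁺ s ⊓ minList (valsWhere (top s) w)

  newT⁻ : State n → (Fin n → ℕ) → ℕ
  newT⁻ s w = T⁻ s ⊔ maxList (valsWhere (λ i → not (top s i)) w)

  -- some node's value leaves its filter [thr, ∞] resp. [-∞, thr]
  Violation : (Fin n → ℕ) → State n → Set
  Violation w s = (∃[ i ] (top s i ≡ true × w i < thr s)) ⊎ (∃[ i ] (top s i ≡ false × thr s < w i))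

  data StepOutcome (k m : ℕ) (w : Fin n → ℕ) (s : State n) : ℕ × State n → Set where
    quiet   : StepOutcome k m w s (0 , s)
    handled : ∀ c → c ≤ 3 * m + 1 → Violation w s → newT⁻ s w ≤ newT⁺ s w →
              StepOutcome k m w s (c , st (top s) (mid (newT⁻ s w) (newT⁺ s w)) (newT⁺ s w) (newT⁻ s w))
    reset   : ∀ c → c ≤ 3 * m + resetCost k m → newT⁺ s w < newT⁻ s w →
              StepOutcome k m w s (c , resetState k w)

  any-witness : (P : Fin n → Bool) → any P (allFin n) ≡ true → ∃[ i ] (P i ≡ true)
  any-witness P found with Any.satisfied (any⁻ P (allFin n) (Equivalence.from T-≡ found))
  ... | i , Pi = i , Equivalence.to T-≡ Pi

  protocolCalls≤3 : ∀ a b m → (b2n a + b2n b + 1) * m ≤ 3 * m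
  protocolCalls≤3 a b m = *-monoˡ-≤ m (+-monoˡ-≤ 1 (+-mono-≤ (b2n≤1 a) (b2n≤1 b)))
    where
    b2n≤1 : ∀ x → b2n x ≤ 1
    b2n≤1 true  = ≤-refl
    b2n≤1 false = z≤n

  module _ (w : Fin n → ℕ) (s : State n) where

    topViolation : any (λ i → top s i ∧ (w i <ᵇ thr s)) (allFin n) ≡ true → Violation w s
    topViolation found with any-witness _ found
    ... | i , e = inj₁ (i , ∧-conicalˡ _ _ e , <ᵇ⇒<′ (∧-conicalʳ _ _ e))

    restViolation : any (λ i → not (top s i) ∧ (thr s <ᵇ w i)) (allFin n) ≡ true → Violation w s
    restViolation found with any-witness _ found
    ... | i , e = inj₂ (i , not-injective (∧-conicalˡ _ _ e) , <ᵇ⇒<′ (∧-conicalʳ _ _ e))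

  step-cases : ∀ k m w s → StepOutcome k m w s (step k m w s)
  step-cases k m w s
    with any (λ i → top s i ∧ (w i <ᵇ thr s)) (allFin n) in topViol
       | any (λ i → not (top s i) ∧ (thr s <ᵇ w i)) (allFin n) in restViol
       | newT⁺ s w <ᵇ newT⁻ s w | <ᵇ-reflects-< (newT⁺ s w) (newT⁻ s w)
  ... | false | false | _     | _            = quiet
  ... | true  | vo    | true  | ofʸ crossed  =
    reset _ (+-monoˡ-≤ _ (protocolCalls≤3 true vo m)) crossed
  ... | true  | vo    | false | ofⁿ ordered  =
    handled _ (+-monoˡ-≤ 1 (protocolCalls≤3 true vo m)) (topViolation w s topViol) (≮⇒≥ ordered)
  ... | false | true  | true  | ofʸ crossed  =
    reset _ (+-monoˡ-≤ _ (protocolCalls≤3 false true m)) crossed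
  ... | false | true  | false | ofⁿ ordered  =
    handled _ (+-monoˡ-≤ 1 (protocolCalls≤3 false true m)) (restViolation w s restViol) (≮⇒≥ ordered)

  violation-avoids-threshold : ∀ {w s} → Violation w s → newT⁺ s w < thr s ⊎ thr s < newT⁻ s w
  violation-avoids-threshold {w} {s} (inj₁ (i , i-top , wi<thr)) =
    inj₁ (≤-<-trans (m≤n⇒o⊓m≤n (T⁺ s) (minWhere-≤ (top s) w i-top)) wi<thr)
  violation-avoids-threshold {w} {s} (inj₂ (i , i-rest , thr<wi)) =
    inj₂ (<-≤-trans thr<wi (m≤n⇒m≤o⊔n (T⁻ s) (maxWhere-≥ (λ j → not (top s j)) w (cong not i-rest))))

gap≤Δ : ∀ {n} k (v : ℕ → Fin n → ℕ) {t₀ t} → t₀ ≤ t → gap k (v t₀) ≤ Δ k v t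
gap≤Δ k v t₀≤t = go (≤⇒≤′ t₀≤t)
  where
  atEnd : ∀ t → gap k (v t) ≤ Δ k v t
  atEnd zero    = ≤-refl
  atEnd (suc t) = m≤n⊔m (Δ k v t) _
  go : ∀ {t₀ t} → t₀ ≤′ t → gap k (v t₀) ≤ Δ k v t
  go {t₀} ≤′-refl  = atEnd t₀
  go (≤′-step le)  = ≤-trans (go le) (m≤m⊔n _ _)

module Analysis {n : ℕ} (k m T : ℕ) (v : ℕ → Fin n → ℕ) (1≤k : 1 ≤ k) (k<n : k < n) (1≤m : 1 ≤ m)
  (admissible : ∀ t → t ≤ T → Injective _≡_ _≡_ (v t))
  (F : ℕ → Filters n) (F-valid : ValidSchedule k v T F) where

  lg : ℕ
  lg = ⌊log₂ (Δ k v T) ⌋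

  B : ℕ
  B = (lg + k) * m

  -- (k + c) · M(n) ≤ (1 + c) · B, as k + c ≤ (1 + c) k for k ≥ 1
  scaled≤B : ∀ c → (k + c) * m ≤ (1 + c) * B
  scaled≤B c = begin
    (k + c) * m             ≤⟨ *-monoˡ-≤ m (+-monoʳ-≤ k c≤ck) ⟩
    (1 + c) * k * m         ≤⟨ *-monoˡ-≤ m (*-monoʳ-≤ (1 + c) (m≤n+m k lg)) ⟩
    (1 + c) * (lg + k) * m  ≡⟨ *-assoc (1 + c) (lg + k) m ⟩
    (1 + c) * B             ∎
    where
    open ≤-Reasoning
    c≤ck : c ≤ c * k
    c≤ck = ≤-trans (≤-reflexive (sym (*-identityʳ c))) (*-monoʳ-≤ c 1≤k)

  resetCost≤ : resetCost k m ≤ 3 * B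
  resetCost≤ = ≤-trans (+-monoʳ-≤ ((k + 1) * m) 1≤m) (≤-trans (≤-reflexive (regroup k m)) (scaled≤B 2))
    where
    regroup : ∀ k m → (k + 1) * m + m ≡ (k + 2) * m
    regroup = solve-∀

  handlerCost≤ : 3 * m + 1 ≤ 4 * m
  handlerCost≤ = ≤-trans (+-monoʳ-≤ (3 * m) 1≤m) (≤-reflexive (+-comm (3 * m) m))

  resetStepCost≤ : 3 * m + resetCost k m ≤ 6 * B
  resetStepCost≤ = ≤-trans (+-monoʳ-≤ (3 * m) (+-monoʳ-≤ ((k + 1) * m) 1≤m))
                           (≤-trans (≤-reflexive (regroup k m)) (scaled≤B 5))
    where
    regroup : ∀ k m → 3 * m + ((k + 1) * m + m) ≡ (k + 5) * m
    regroup = solve-∀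

  roundsCost≤ : ∀ {j} → j ≤ lg + 1 → 4 * m * j ≤ 4 * B
  roundsCost≤ {j} j≤ = ≤-trans (*-monoʳ-≤ (4 * m) (≤-trans j≤ (+-monoʳ-≤ lg 1≤k)))
                               (≤-reflexive (trans (*-assoc 4 m (lg + k)) (cong (4 *_) (*-comm m (lg + k)))))

  -- some node of S held a value ≤ x at a time of [t₀, t] (the role of T⁺) ...
  LowWitness : ℕ → ℕ → (Fin n → Bool) → ℕ → Set
  LowWitness t₀ t S x = ∃[ r ] ∃[ p ] (t₀ ≤ r × r ≤ t × S p ≡ true × v r p ≤ x)

  -- ... and x is 0 or some node outside S held a value ≥ x (the role of T⁻)
  HighWitness : ℕ → ℕ → (Fin n → Bool) → ℕ → Set
  HighWitness t₀ t S x = x ≡ 0 ⊎ ∃[ r ] ∃[ q ] (t₀ ≤ r × r ≤ t × S q ≡ false × x ≤ v r q)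

  low-later : ∀ {t₀ t S x} → LowWitness t₀ t S x → LowWitness t₀ (suc t) S x
  low-later (r , p , t₀≤r , r≤t , Sp , vp≤x) = r , p , t₀≤r , m≤n⇒m≤1+n r≤t , Sp , vp≤x

  high-later : ∀ {t₀ t S x} → HighWitness t₀ t S x → HighWitness t₀ (suc t) S x
  high-later (inj₁ x≡0) = inj₁ x≡0
  high-later (inj₂ (r , q , t₀≤r , r≤t , Sq , x≤vq)) = inj₂ (r , q , t₀≤r , m≤n⇒m≤1+n r≤t , Sq , x≤vq)

  low-update : ∀ {t₀ t S x} → t₀ ≤ suc t → LowWitness t₀ t S x →
    LowWitness t₀ (suc t) S (x ⊓ minList (valsWhere S (v (suc t))))
  low-update {t₀} {t} {S} {x} t₀≤ wit@(_ , p , _ , _ , Sp , _) with ⊓-sel x (minList (valsWhere S (v (suc t))))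
  ... | inj₁ ⊓≡x   = subst (LowWitness t₀ (suc t) S) (sym ⊓≡x) (low-later wit)
  ... | inj₂ ⊓≡min with minWhere-attained S (v (suc t)) Sp
  ...   | p′ , Sp′ , min≡ = suc t , p′ , t₀≤ , ≤-refl , Sp′ , ≤-reflexive (sym (trans ⊓≡min min≡))

  high-update : ∀ {t₀ t S x} → t₀ ≤ suc t → HighWitness t₀ t S x →
    HighWitness t₀ (suc t) S (x ⊔ maxList (valsWhere (λ i → not (S i)) (v (suc t))))
  high-update {t₀} {t} {S} {x} t₀≤ wit with ⊔-sel x (maxList (valsWhere (λ i → not (S i)) (v (suc t))))
  ... | inj₁ ⊔≡x   = subst (HighWitness t₀ (suc t) S) (sym ⊔≡x) (high-later wit)
  ... | inj₂ ⊔≡max with maxWhere-attained (λ i → not (S i)) (v (suc t))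
  ...   | inj₁ max≡0             = inj₁ (trans ⊔≡max max≡0)
  ...   | inj₂ (q , ¬Sq , max≡)  =
    inj₂ (suc t , q , t₀≤ , ≤-refl , not-injective ¬Sq , ≤-reflexive (trans ⊔≡max max≡))

  -- If OPT keeps its filters during [t₀, t], all values seen in
  -- that period lie in the filter set F t₀ of v t₀, so by separation the
  -- witnessed bounds for the top-k set of v t₀ cannot cross.
  crossing⇒change : ∀ {t₀ t S x y} → t ≤ T → t₀ ≤ t → (∀ i → S i ≡ inTop k (v t₀) i) →
    LowWitness t₀ t S x → HighWitness t₀ t S y → x < y → numChanges F t₀ < numChanges F t
  crossing⇒change _ _ _ _ (inj₁ refl) ()
  crossing⇒change {t₀} {t} {S} t≤T t₀≤t S≡ (r , p , t₀≤r , r≤t , Sp , vp≤x) (inj₂ (r′ , q , t₀≤r′ , r′≤t , Sq , y≤vq)) x<y =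
    ≰⇒> λ stays → <⇒≱ (≤-<-trans vp≤x (<-≤-trans x<y y≤vq))
      (separation k (F-valid t₀ (≤-trans t₀≤t t≤T))
         (admissible r (≤-trans r≤t t≤T)) (admissible r′ (≤-trans r′≤t t≤T))
         (inside r t₀≤r r≤t stays) (inside r′ t₀≤r′ r′≤t stays)
         (trans (sym (S≡ p)) Sp) (trans (sym (S≡ q)) Sq))
    where
    inside : ∀ r → t₀ ≤ r → r ≤ t → numChanges F t ≤ numChanges F t₀ → ∀ i → v r i ∈I F t₀ i
    inside r t₀≤r r≤t stays i =
      subst (v r i ∈I_) (numChanges-stable F t₀≤r (≤-trans (numChanges-mono F r≤t) stays) i)
            (proj₁ (F-valid r (≤-trans r≤t t≤T)) i)

  -- The current phase began with a FilterReset at time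
  -- t₀ and has seen 'rounds' narrowing handler calls since; each of them
  -- halved the interval [T⁻, T⁺], which initially had length gap + 1.
  -- Every earlier phase ended with a reset charged to a filter change of OPT.
  record Phase (t c : ℕ) (s : State n) : Set where
    field
      t₀        : ℕ
      t₀≤t      : t₀ ≤ t
      rounds    : ℕ
      top≡      : ∀ i → top s i ≡ inTop k (v t₀) i
      thr≡      : thr s ≡ mid (T⁻ s) (T⁺ s)
      low       : LowWitness t₀ t (top s) (T⁺ s)
      high      : HighWitness t₀ t (top s) (T⁻ s)
      potential : 2 ^ rounds * (T⁺ s ∸ T⁻ s + 1) ≤ gap k (v t₀) + 1
      budget    : c ≤ 3 * B + numChanges F t₀ * (10 * B) + 4 * m * rounds

  -- halving more than log Δ + 1 times would empty the interval
  rounds≤ : ∀ {t c s} → t ≤ T → (P : Phase t c s) → Phase.rounds P ≤ lg + 1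
  rounds≤ {s = s} t≤T P = log-bound rounds (Δ k v T) (begin
    2 ^ rounds                          ≡⟨ sym (*-identityʳ (2 ^ rounds)) ⟩
    2 ^ rounds * 1                      ≤⟨ *-monoʳ-≤ (2 ^ rounds) (m≤n+m 1 (T⁺ s ∸ T⁻ s)) ⟩
    2 ^ rounds * (T⁺ s ∸ T⁻ s + 1)      ≤⟨ potential ⟩
    gap k (v t₀) + 1                 ≤⟨ +-monoˡ-≤ 1 (gap≤Δ k v (≤-trans t₀≤t t≤T)) ⟩
    Δ k v T + 1                         ∎)
    where
    open Phase P
    open ≤-Reasoning

  reset-phase : ∀ t c → c ≤ 3 * B + numChanges F t * (10 * B) → Phase t c (resetState k (v t))
  reset-phase t c c≤ = record
    { t₀ = t ; t₀≤t = ≤-refl ; rounds = 0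
    ; top≡ = λ _ → refl ; thr≡ = refl
    ; low = low₀ ; high = high₀
    ; potential = ≤-reflexive (*-identityˡ _)
    ; budget = ≤-trans c≤ (m≤m+n _ _) }
    where
    S : Fin n → Bool
    S = inTop k (v t)
    low₀ : LowWitness t t S (minList (valsWhere S (v t)))
    low₀ with inTop-nonempty k (v t) 1≤k (fromℕ< k<n)
    ... | p₀ , p₀-top with minWhere-attained S (v t) p₀-top
    ...   | p , Sp , min≡ = t , p , ≤-refl , ≤-refl , Sp , ≤-reflexive (sym min≡)
    high₀ : HighWitness t t S (maxList (valsWhere (λ i → not (S i)) (v t)))
    high₀ with maxWhere-attained (λ i → not (S i)) (v t)
    ... | inj₁ max≡0            = inj₁ max≡0
    ... | inj₂ (q , ¬Sq , max≡) = inj₂ (t , q , ≤-refl , ≤-refl , not-injective ¬Sq , ≤-reflexive max≡)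

  module Step {t c : ℕ} {s : State n} (t<T : suc t ≤ T) (P : Phase t c s) where
    open Phase P
    w : Fin n → ℕ
    w = v (suc t)

    t₀≤t+1 : t₀ ≤ suc t
    t₀≤t+1 = m≤n⇒m≤1+n t₀≤t

    quiet-phase : Phase (suc t) (c + 0) s
    quiet-phase = record
      { t₀ = t₀ ; t₀≤t = t₀≤t+1 ; rounds = rounds ; top≡ = top≡ ; thr≡ = thr≡
      ; low = low-later low ; high = high-later high ; potential = potential
      ; budget = ≤-trans (≤-reflexive (+-identityʳ c)) budget }

    handled-phase : ∀ {c′} → c′ ≤ 3 * m + 1 → Violation w s → newT⁻ s w ≤ newT⁺ s w →
      Phase (suc t) (c + c′) (st (top s) (mid (newT⁻ s w) (newT⁺ s w)) (newT⁺ s w) (newT⁻ s w))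
    handled-phase {c′} c′≤ violation ordered = record
      { t₀ = t₀ ; t₀≤t = t₀≤t+1 ; rounds = suc rounds ; top≡ = top≡ ; thr≡ = refl
      ; low = low-update t₀≤t+1 low ; high = high-update t₀≤t+1 high
      ; potential = potential′ ; budget = budget′ }
      where
      open ≤-Reasoning
      halves : 2 * (newT⁺ s w ∸ newT⁻ s w + 1) ≤ T⁺ s ∸ T⁻ s + 1
      halves = midpoint-halves (m≤m⊔n (T⁻ s) _) ordered (m⊓n≤m (T⁺ s) _)
                 (subst (λ M → newT⁺ s w < M ⊎ M < newT⁻ s w) thr≡ (violation-avoids-threshold violation))
      potential′ : 2 ^ suc rounds * (newT⁺ s w ∸ newT⁻ s w + 1) ≤ gap k (v t₀) + 1
      potential′ = begin
        2 * 2 ^ rounds * L                ≡⟨ cong (_* L) (*-comm 2 (2 ^ rounds)) ⟩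
        2 ^ rounds * 2 * L                ≡⟨ *-assoc (2 ^ rounds) 2 L ⟩
        2 ^ rounds * (2 * L)              ≤⟨ *-monoʳ-≤ (2 ^ rounds) halves ⟩
        2 ^ rounds * (T⁺ s ∸ T⁻ s + 1)    ≤⟨ potential ⟩
        gap k (v t₀) + 1                  ∎
        where
        L : ℕ
        L = newT⁺ s w ∸ newT⁻ s w + 1
      budget′ : c + c′ ≤ 3 * B + numChanges F t₀ * (10 * B) + 4 * m * suc rounds
      budget′ = begin
        c + c′                                   ≤⟨ +-mono-≤ budget (≤-trans c′≤ handlerCost≤) ⟩
        A + 4 * m * rounds + 4 * m               ≡⟨ regroup A (4 * m) rounds ⟩
        A + 4 * m * suc rounds                   ∎
        where
        A : ℕ
        A = 3 * B + numChanges F t₀ * (10 * B)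
        regroup : ∀ A x j → A + x * j + x ≡ A + x * (1 + j)
        regroup = solve-∀

    -- the candidates cross: OPT changed its filters during this phase,
    -- which pays for this phase and the reset
    reset-after : ∀ {c′} → c′ ≤ 3 * m + resetCost k m → newT⁺ s w < newT⁻ s w →
      Phase (suc t) (c + c′) (resetState k w)
    reset-after {c′} c′≤ crossed = reset-phase (suc t) (c + c′) (begin
      c + c′                                          ≤⟨ +-mono-≤ budget (≤-trans c′≤ resetStepCost≤) ⟩
      3 * B + N₀ * (10 * B) + 4 * m * rounds + 6 * B  ≤⟨ +-monoˡ-≤ (6 * B) (+-monoʳ-≤ (3 * B + N₀ * (10 * B))
                                                           (roundsCost≤ (rounds≤ (≤-trans (n≤1+n t) t<T) P))) ⟩
      3 * B + N₀ * (10 * B) + 4 * B + 6 * B           ≡⟨ regroup B N₀ ⟩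
      3 * B + suc N₀ * (10 * B)                       ≤⟨ +-monoʳ-≤ (3 * B) (*-monoˡ-≤ (10 * B) optChanged) ⟩
      3 * B + numChanges F (suc t) * (10 * B)         ∎)
      where
      open ≤-Reasoning
      N₀ : ℕ
      N₀ = numChanges F t₀
      regroup : ∀ B N → 3 * B + N * (10 * B) + 4 * B + 6 * B ≡ 3 * B + (1 + N) * (10 * B)
      regroup = solve-∀
      optChanged : suc N₀ ≤ numChanges F (suc t)
      optChanged = crossing⇒change t<T t₀≤t+1 top≡ (low-update t₀≤t+1 low) (high-update t₀≤t+1 high) crossed

  step-phase : ∀ {t c s r} → suc t ≤ T → Phase t c s → StepOutcome k m (v (suc t)) s r →
    Phase (suc t) (c + proj₁ r) (proj₂ r)
  step-phase t<T P quiet                              = Step.quiet-phase t<T P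
  step-phase t<T P (handled _ c′≤ violation ordered)  = Step.handled-phase t<T P c′≤ violation ordered
  step-phase t<T P (reset _ c′≤ crossed)              = Step.reset-after t<T P c′≤ crossed

  run-phase : ∀ t → t ≤ T → Phase t (algCost k m v t) (proj₂ (run k m v t))
  run-phase zero    _   = reset-phase 0 _ (≤-trans resetCost≤ (m≤m+n _ _))
  run-phase (suc t) t<T = step-phase t<T (run-phase t (≤-trans (n≤1+n t) t<T))
                            (step-cases k m (v (suc t)) (proj₂ (run k m v t)))

  -- at the horizon, the open phase costs at most 3B + 4B on top of 10B per
  -- filter change of OPT
  competitive : algCost k m v T ≤ 10 * B * scheduleCost F T
  competitive = begin
    algCost k m v T                           ≤⟨ budget ⟩
    3 * B + N₀ * (10 * B) + 4 * m * rounds    ≤⟨ +-mono-≤ (+-monoʳ-≤ (3 * B) (*-monoˡ-≤ (10 * B) (numChanges-mono F t₀≤t)))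
                                                          (roundsCost≤ (rounds≤ ≤-refl P)) ⟩
    3 * B + N * (10 * B) + 4 * B              ≤⟨ m≤m+n _ (3 * B) ⟩
    3 * B + N * (10 * B) + 4 * B + 3 * B      ≡⟨ regroup B N ⟩
    10 * B * (1 + N)                          ∎
    where
    open ≤-Reasoning
    P : Phase T (algCost k m v T) (proj₂ (run k m v T))
    P = run-phase T ≤-refl
    open Phase P
    N₀ N : ℕ
    N₀ = numChanges F t₀
    N = numChanges F T
    regroup : ∀ B N → 3 * B + N * (10 * B) + 4 * B + 3 * B ≡ 10 * B * (1 + N)
    regroup = solve-∀

theorem1 : ∃[ c ] ((n k m T : ℕ) (v : ℕ → Fin n → ℕ) → 1 ≤ k → k < n → 1 ≤ m →
    (∀ t → t ≤ T → Injective _≡_ _≡_ (v t)) →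
    (F : ℕ → Filters n) → ValidSchedule k v T F →
    algCost k m v T ≤ c * ((⌊log₂ (Δ k v T) ⌋ + k) * m) * scheduleCost F T)
theorem1 = 10 , λ n k m T v 1≤k k<n 1≤m admissible F F-valid →
  Analysis.competitive k m T v 1≤k k<n 1≤m admissible F F-valid
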